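{- Let $r,p,k,x$ be positive integers with $2\le p\le r$ and $k\ge p$. Every $k$-uniform hypergraph $G=(V,E)$ with $$|E|\ \le\ \frac{1}{2}\left(\frac{r^k}{(p-1)^k\binom{r}{p-1}}\right)^x$$ has a strong $(r,p)$ cover of size $x$; that is, $\chi^c(G,k,r,p)\le x$.
   Context: For a $k$-uniform hypergraph $G=(V,E)$, an $r$-coloring is a map $V\to\{1,\dots,r\}$. A hyperedge $e$ is properly $(r,p)$ colored by an $r$-coloring if $e$ contains at least $\min(p,|e|)$ vertices of pairwise distinct colors. A strong $(r,p)$ cover of $G$ is a set of $r$-colorings of $V$ such that every hyperedge is properly $(r,p)$ colored by at least one of them; $\chi^c(G,k,r,p)$ is the minimum cardinality of such a cover. -}

module Defs where

open import Data.Nat using (ℕ; _≤_; _*_; _^_; _∸_; _⊓_)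
open import Data.Nat.Combinatorics using (_C_)
open import Data.Fin using (Fin)
open import Data.Fin.Subset using (Subset; _⊆_; _∈_; ∣_∣)
open import Data.List using (List; length)
open import Data.List.Relation.Unary.All using (All)
open import Data.List.Relation.Unary.Any using (Any)
open import Data.List.Relation.Unary.Unique.Propositional using (Unique)
open import Data.Product using (Σ; _×_)
open import Relation.Binary.PropositionalEquality using (_≡_)

record Hypergraph (n : ℕ) : Set where
  field
    edges  : List (Subset n)
    unique : Unique edges

open Hypergraph public

numEdges : ∀ {n} → Hypergraph n → ℕ
numEdges G = length (edges G)

Uniform : ∀ {n} → ℕ → Hypergraph n → Set
Uniform k G = All (λ e → ∣ e ∣ ≡ k) (edges G)

Coloring : ℕ → ℕ → Set
Coloring n r = Fin n → Fin r

ProperlyColored : ∀ {n r} → ℕ → Coloring n r → Subset n → Set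
ProperlyColored {n} p c e =
  Σ (Subset n) λ S →
    S ⊆ e × (p ⊓ ∣ e ∣) ≤ ∣ S ∣ ×
    (∀ u v → u ∈ S → v ∈ S → c u ≡ c v → u ≡ v)

StrongCover : ∀ {n} (r p : ℕ) → Hypergraph n → (x : ℕ) → (Fin x → Coloring n r) → Set
StrongCover r p G x cs =
  All (λ e → Σ (Fin x) λ i → ProperlyColored p (cs i) e) (edges G)

-- χ^c(G,k,r,p) ≤ x : there is a strong (r,p) cover of cardinality at most x
-- (a family of x colorings, repetitions allowed)
χᶜ≤ : ∀ {n} → Hypergraph n → (r p x : ℕ) → Set
χᶜ≤ {n} G r p x = Σ (Fin x → Coloring n r) λ cs → StrongCover r p G x cs

-- Strong (r,p) covers of sparse uniform hypergraphs, by the first-moment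
-- method carried out as exact counting.
--
-- Write q = p ∸ 1.  Call an r-colouring c *confined* on an edge e when c maps
-- e into some q-set of colours.  The proof has three parts.
--
--  * Dichotomy.  Greedily choosing one vertex of e per new colour yields a
--    rainbow set S ⊆ e whose colours cover c(e).  If |S| ≥ p then e is
--    properly (r,p) coloured, otherwise c(e) lies in a set of at most q, hence
--    in a set of exactly q colours: a colouring that is not confined on e
--    colours e properly.
--  * One edge.  Counting colourings vertex by vertex, exactly |K|^|e| r^(n-|e|)
--    colourings map e into a colour set K; summing over the r C q sets K, at
--    most (q^k · r C q) r^(n-k) colourings are confined on a k-edge.
--  * All edges.  A family of x colourings is bad for e when each member is
--    confined on e; there are at most (q^k · r C q)^x (r^n)^x / (r^k)^x of
--    them.  The hypothesis makes |E| times this less than half of all (r^n)^x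
--    families, so some family is bad for no edge, and it is a strong cover.
module Submission where

open import Defs
open import Data.Nat using (ℕ; _≤_; _*_; _^_; _∸_)
open import Data.Nat.Combinatorics using (_C_)
open import Data.Nat using (zero; suc; _+_; _<_; z≤n; s≤s; NonZero; >-nonZero)
open import Data.Nat.Properties
open import Data.Nat.Combinatorics using (nCk+nC[k+1]≡[n+1]C[k+1]; k>n⇒nCk≡0)
open import Algebra.Properties.CommutativeSemigroup *-commutativeSemigroup
  using (interchange; x∙yz≈y∙xz)
open import Data.Bool using (Bool; true; false; T; not; _∧_; _∨_; if_then_else_)
open import Data.Bool.Properties using (T-∧)
open import Data.Bool.ListAction using (any)
open import Data.Unit using (tt)
open import Data.Empty using (⊥-elim)
open import Data.Fin using (Fin; zero; suc)
open import Data.Fin.Subset using (Subset; inside; outside; ⊥; ⁅_⁆; _∪_; _∈_; _⊆_; ∣_∣)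
open import Data.Fin.Subset.Properties
  using (_∈?_; ∣⊥∣≡0; ∣p∣≤n; ∣⁅x⁆∣≡1; x∈⁅x⁆; x∈⁅y⁆⇒x≡y; x∈p∪q⁺; p⊆q⇒∣p∣≤∣q∣; ∪-identityʳ)
open import Data.Vec using ([]; _∷_; lookup; here; there)
import Data.Vec as Vec
open import Data.Vec.Properties using ([]=⇒lookup; lookup⇒[]=; tabulate∘lookup)
open import Data.Vec.Functional using () renaming ([] to []ᶠ; _∷_ to _∷ᶠ_)
open import Data.List using (List; []; _∷_; _++_; map; concatMap; length; allFin; tabulate)
open import Data.List.Properties using (length-++; length-map; length-tabulate)
open import Data.List.Relation.Unary.All as All using (All; []; _∷_)
import Data.List.Relation.Unary.All.Properties as All
import Data.List.Relation.Unary.Any as Any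
open import Data.List.Relation.Unary.Any.Properties using (any⁺)
open import Data.List.Membership.Propositional using () renaming (_∈_ to _∈ₗ_)
open import Data.List.Membership.Propositional.Properties using (∈-map⁺; ∈-++⁺ˡ; ∈-++⁺ʳ)
open import Data.Product using (Σ; _×_; _,_; proj₁; proj₂)
open import Data.Sum using (_⊎_; inj₁; inj₂)
open import Function using (_∘_; Equivalence)
open import Relation.Nullary using (¬_; Dec; yes; no; contradiction)
open import Relation.Binary.PropositionalEquality

count : {A : Set} → (A → Bool) → List A → ℕ
count P []      = 0
count P (a ∷ L) = if P a then suc (count P L) else count P L

count-++ : {A : Set} (P : A → Bool) (L₁ L₂ : List A) →
  count P (L₁ ++ L₂) ≡ count P L₁ + count P L₂
count-++ P []       L₂ = refl
count-++ P (a ∷ L₁) L₂ with P a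
... | true  = cong suc (count-++ P L₁ L₂)
... | false = count-++ P L₁ L₂

count-map : {A B : Set} (P : B → Bool) (f : A → B) (L : List A) →
  count P (map f L) ≡ count (P ∘ f) L
count-map P f []      = refl
count-map P f (a ∷ L) with P (f a)
... | true  = cong suc (count-map P f L)
... | false = count-map P f L

count-false : {A : Set} (L : List A) → count (λ _ → false) L ≡ 0
count-false []      = refl
count-false (a ∷ L) = count-false L

count-true : {A : Set} (L : List A) → count (λ _ → true) L ≡ length L
count-true []      = refl
count-true (a ∷ L) = cong suc (count-true L)

count-∨ : {A : Set} (P Q : A → Bool) (L : List A) →
  count (λ a → P a ∨ Q a) L ≤ count P L + count Q L
count-∨ P Q []      = z≤n
count-∨ P Q (a ∷ L) with P a | Q a
... | true  | true  = s≤s (≤-trans (count-∨ P Q L) (+-monoʳ-≤ (count P L) (n≤1+n _)))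
... | true  | false = s≤s (count-∨ P Q L)
... | false | true  =
  subst (suc (count (λ a → P a ∨ Q a) L) ≤_) (sym (+-suc (count P L) (count Q L))) (s≤s (count-∨ P Q L))
... | false | false = count-∨ P Q L

-- the union bound for a list of tests, in a weighted form (division-free):
-- if every test passes at most M / R elements, the union passes at most
-- |Ts| · M / R elements
union-bound : {A B : Set} (P : B → A → Bool) (L : List A) (R M : ℕ) (Ts : List B) →
  All (λ t → count (P t) L * R ≤ M) Ts →
  count (λ a → any (λ t → P t a) Ts) L * R ≤ length Ts * M
union-bound P L R M []       []         = ≤-reflexive (cong (_* R) (count-false L))
union-bound P L R M (t ∷ Ts) (bt ∷ bTs) = begin
  count (λ a → P t a ∨ any (λ t → P t a) Ts) L * R
    ≤⟨ *-monoˡ-≤ R (count-∨ (P t) _ L) ⟩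
  (count (P t) L + count (λ a → any (λ t → P t a) Ts) L) * R
    ≡⟨ *-distribʳ-+ R (count (P t) L) _ ⟩
  count (P t) L * R + count (λ a → any (λ t → P t a) Ts) L * R
    ≤⟨ +-mono-≤ bt (union-bound P L R M Ts bTs) ⟩
  M + length Ts * M ∎
  where open ≤-Reasoning

count-witness : {A : Set} (P : A → Bool) (L : List A) →
  count P L < length L → Σ A (λ a → ¬ T (P a))
count-witness P (a ∷ L) lt with P a in eq
... | false = a , subst T eq
... | true  = count-witness P L (≤-pred lt)

-- Enumerating all functions Fin m → A with values in a list

every : (m : ℕ) → (Fin m → Bool) → Bool
every zero    P = true
every (suc m) P = P zero ∧ every m (P ∘ suc)

∏ : (m : ℕ) → (Fin m → ℕ) → ℕ
∏ zero    f = 1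
∏ (suc m) f = f zero * ∏ m (f ∘ suc)

every-intro : (m : ℕ) (P : Fin m → Bool) → (∀ i → T (P i)) → T (every m P)
every-intro zero    P h = tt
every-intro (suc m) P h = Equivalence.from T-∧ (h zero , every-intro m (P ∘ suc) (h ∘ suc))

every-elim : (m : ℕ) (P : Fin m → Bool) → ¬ T (every m P) → Σ (Fin m) (λ i → ¬ T (P i))
every-elim zero    P h = ⊥-elim (h tt)
every-elim (suc m) P h with P zero in eq
... | false = zero , subst T eq
... | true  = let (i , hi) = every-elim m (P ∘ suc) h in suc i , hi

∏-cong : (m : ℕ) (f g : Fin m → ℕ) → (∀ i → f i ≡ g i) → ∏ m f ≡ ∏ m g
∏-cong zero    f g eq = refl
∏-cong (suc m) f g eq = cong₂ _*_ (eq zero) (∏-cong m (f ∘ suc) (g ∘ suc) (eq ∘ suc))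

∏-const : (m a : ℕ) → ∏ m (λ _ → a) ≡ a ^ m
∏-const zero    a = refl
∏-const (suc m) a = cong (a *_) (∏-const m a)

tuples : {A : Set} (m : ℕ) → List A → List (Fin m → A)
tuples zero    L = []ᶠ ∷ []
tuples (suc m) L = concatMap (λ a → map (a ∷ᶠ_) (tuples m L)) L

count-prepend : {A : Set} {m : ℕ} (Q : A → Bool) (R : (Fin m → A) → Bool)
  (L : List A) (F : List (Fin m → A)) →
  count (λ f → Q (f zero) ∧ R (f ∘ suc)) (concatMap (λ a → map (a ∷ᶠ_) F) L)
    ≡ count Q L * count R F
count-prepend Q R []      F = refl
count-prepend {A} {m} Q R (a ∷ L) F = begin
  count S (map (a ∷ᶠ_) F ++ rest)        ≡⟨ count-++ S (map (a ∷ᶠ_) F) rest ⟩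
  count S (map (a ∷ᶠ_) F) + count S rest ≡⟨ cong₂ _+_ (count-map S (a ∷ᶠ_) F) (count-prepend Q R L F) ⟩
  count (λ g → Q a ∧ R g) F + count Q L * count R F
                                         ≡⟨ head-case (Q a) ⟩
  count Q (a ∷ L) * count R F            ∎
  where
  open ≡-Reasoning
  S : (Fin (suc m) → A) → Bool
  S f = Q (f zero) ∧ R (f ∘ suc)
  rest : List (Fin (suc m) → A)
  rest = concatMap (λ a → map (a ∷ᶠ_) F) L
  head-case : ∀ b → count (λ g → b ∧ R g) F + count Q L * count R F
                      ≡ (if b then suc (count Q L) else count Q L) * count R F
  head-case true  = refl
  head-case false = cong (_+ count Q L * count R F) (count-false F)

length-prepend : {A : Set} {m : ℕ} (L : List A) (F : List (Fin m → A)) →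
  length (concatMap (λ a → map (a ∷ᶠ_) F) L) ≡ length L * length F
length-prepend []      F = refl
length-prepend (a ∷ L) F =
  trans (length-++ (map (a ∷ᶠ_) F)) (cong₂ _+_ (length-map (a ∷ᶠ_) F) (length-prepend L F))

count-tuples : {A : Set} (m : ℕ) (Q : Fin m → A → Bool) (L : List A) →
  count (λ f → every m (λ i → Q i (f i))) (tuples m L) ≡ ∏ m (λ i → count (Q i) L)
count-tuples zero    Q L = refl
count-tuples (suc m) Q L =
  trans (count-prepend (Q zero) (λ g → every m (λ i → Q (suc i) (g i))) L (tuples m L))
        (cong (count (Q zero) L *_) (count-tuples m (Q ∘ suc) L))

length-tuples : {A : Set} (m : ℕ) (L : List A) → length (tuples m L) ≡ length L ^ m
length-tuples zero    L = refl
length-tuples (suc m) L =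
  trans (length-prepend L (tuples m L)) (cong (length L *_) (length-tuples m L))

count-allFin : {r : ℕ} (K : Subset r) → count (lookup K) (allFin r) ≡ ∣ K ∣
count-allFin {r} K = begin
  count (lookup K) (allFin r)              ≡⟨ count-tabulate (lookup K) (λ i → i) ⟩
  ∣ Vec.tabulate (lookup K) ∣              ≡⟨ cong ∣_∣ (tabulate∘lookup K) ⟩
  ∣ K ∣                                    ∎
  where
  open ≡-Reasoning
  count-tabulate : ∀ {m} (P : Fin r → Bool) (g : Fin m → Fin r) →
    count P (tabulate g) ≡ ∣ Vec.tabulate (P ∘ g) ∣
  count-tabulate {zero}  P g = refl
  count-tabulate {suc m} P g with P (g zero)
  ... | true  = cong suc (count-tabulate P (g ∘ suc))
  ... | false = count-tabulate P (g ∘ suc)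

length-allFin : (r : ℕ) → length (allFin r) ≡ r
length-allFin r = length-tabulate (λ i → i)

∣p∪⁅x⁆∣ : {r : ℕ} (p : Subset r) (x : Fin r) → ¬ x ∈ p → ∣ p ∪ ⁅ x ⁆ ∣ ≡ suc ∣ p ∣
∣p∪⁅x⁆∣ (inside  ∷ p) zero    x∉p = contradiction here x∉p
∣p∪⁅x⁆∣ (outside ∷ p) zero    x∉p = cong (suc ∘ ∣_∣) (∪-identityʳ p)
∣p∪⁅x⁆∣ (inside  ∷ p) (suc x) x∉p = cong suc (∣p∪⁅x⁆∣ p x (x∉p ∘ there))
∣p∪⁅x⁆∣ (outside ∷ p) (suc x) x∉p = ∣p∪⁅x⁆∣ p x (x∉p ∘ there)

∈⇒∣p∣≥1 : {r : ℕ} {x : Fin r} {p : Subset r} → x ∈ p → 1 ≤ ∣ p ∣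
∈⇒∣p∣≥1 {x = x} {p} x∈p = subst (_≤ ∣ p ∣) (∣⁅x⁆∣≡1 x)
  (p⊆q⇒∣p∣≤∣q∣ (λ y∈⁅x⁆ → subst (_∈ p) (sym (x∈⁅y⁆⇒x≡y x y∈⁅x⁆)) x∈p))

subsetsOfSize : (r q : ℕ) → List (Subset r)
subsetsOfSize r       zero    = ⊥ ∷ []
subsetsOfSize zero    (suc q) = []
subsetsOfSize (suc r) (suc q) =
  map (inside ∷_) (subsetsOfSize r q) ++ map (outside ∷_) (subsetsOfSize r (suc q))

length-subsetsOfSize : (r q : ℕ) → length (subsetsOfSize r q) ≡ r C q
length-subsetsOfSize r       zero    = refl
length-subsetsOfSize zero    (suc q) = sym (k>n⇒nCk≡0 {0} {suc q} (s≤s z≤n))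
length-subsetsOfSize (suc r) (suc q) = begin
  length (map (inside ∷_) with0 ++ map (outside ∷_) without0)
    ≡⟨ length-++ (map (inside ∷_) with0) ⟩
  length (map (inside ∷_) with0) + length (map (outside ∷_) without0)
    ≡⟨ cong₂ _+_ (length-map _ with0) (length-map _ without0) ⟩
  length with0 + length without0
    ≡⟨ cong₂ _+_ (length-subsetsOfSize r q) (length-subsetsOfSize r (suc q)) ⟩
  r C q + r C (suc q)
    ≡⟨ nCk+nC[k+1]≡[n+1]C[k+1] r q ⟩
  suc r C suc q ∎
  where
  open ≡-Reasoning
  -- the (suc q)-sets of colours containing, resp. avoiding, colour 0, without that colour
  with0 without0 : List (Subset r)
  with0    = subsetsOfSize r q
  without0 = subsetsOfSize r (suc q)

size-subsetsOfSize : (r q : ℕ) → All (λ K → ∣ K ∣ ≡ q) (subsetsOfSize r q)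
size-subsetsOfSize r       zero    = ∣⊥∣≡0 r ∷ []
size-subsetsOfSize zero    (suc q) = []
size-subsetsOfSize (suc r) (suc q) =
  All.++⁺ (All.map⁺ (All.map (cong suc) (size-subsetsOfSize r q)))
          (All.map⁺ (size-subsetsOfSize r (suc q)))

extend-to-size : (r q : ℕ) (U : Subset r) → ∣ U ∣ ≤ q → q ≤ r →
  Σ (Subset r) (λ K → K ∈ₗ subsetsOfSize r q × U ⊆ K)
extend-to-size r zero U ∣U∣≤0 _ =
  ⊥ , Any.here refl , λ x∈U → contradiction (≤-trans (∈⇒∣p∣≥1 x∈U) ∣U∣≤0) λ ()
extend-to-size zero (suc q) U _ ()
extend-to-size (suc r) (suc q) (s ∷ U) ∣sU∣≤q+1 (s≤s q≤r) with ∣ U ∣ ≤? q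
... | yes ∣U∣≤q =
  let (K , K∈ , U⊆K) = extend-to-size r q U ∣U∣≤q q≤r in
  inside ∷ K , ∈-++⁺ˡ (∈-map⁺ (inside ∷_) K∈) ,
  λ { here → here ; (there x∈U) → there (U⊆K x∈U) }
extend-to-size (suc r) (suc q) (inside ∷ U) (s≤s ∣U∣≤q) _ | no ∣U∣≰q = contradiction ∣U∣≤q ∣U∣≰q
extend-to-size (suc r) (suc q) (outside ∷ U) ∣U∣≤q+1 _ | no ∣U∣≰q =
  let (K , K∈ , U⊆K) = extend-to-size r (suc q) U ∣U∣≤q+1 (≤-trans (≰⇒> ∣U∣≰q) (∣p∣≤n U)) in
  outside ∷ K , ∈-++⁺ʳ (map (inside ∷_) (subsetsOfSize r q)) (∈-map⁺ (outside ∷_) K∈) ,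
  λ { (there x∈U) → there (U⊆K x∈U) }

-- The dichotomy: rainbow or confined

record Transversal {n r : ℕ} (c : Coloring n r) (e : Subset n) : Set where
  field
    reps    : Subset n
    colours : Subset r
    reps⊆e  : reps ⊆ e
    size    : ∣ reps ∣ ≡ ∣ colours ∣
    covers  : ∀ {v} → v ∈ e → c v ∈ colours
    rainbow : ∀ {u v} → u ∈ reps → v ∈ reps → c u ≡ c v → u ≡ v

module _ {n r : ℕ} (c : Coloring (suc n) r) {e : Subset n} (t : Transversal (c ∘ suc) e) where
  open Transversal t

  skip-vertex : (s : Bool) → (s ≡ inside → c zero ∈ colours) → Transversal c (s ∷ e)
  skip-vertex s old = record
    { reps    = outside ∷ reps
    ; colours = colours
    ; reps⊆e  = λ { (there v∈reps) → there (reps⊆e v∈reps) }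
    ; size    = size
    ; covers  = covers′
    ; rainbow = λ { (there hu) (there hv) same → cong suc (rainbow hu hv same) }
    }
    where
    covers′ : ∀ {v} → v ∈ (s ∷ e) → c v ∈ colours
    covers′ here        = old refl
    covers′ (there v∈e) = covers v∈e

  add-vertex : ¬ c zero ∈ colours → Transversal c (inside ∷ e)
  add-vertex new = record
    { reps    = inside ∷ reps
    ; colours = colours ∪ ⁅ c zero ⁆
    ; reps⊆e  = λ { here → here ; (there hv) → there (reps⊆e hv) }
    ; size    = trans (cong suc size) (sym (∣p∪⁅x⁆∣ colours (c zero) new))
    ; covers  = λ { here → x∈p∪q⁺ (inj₂ (x∈⁅x⁆ (c zero)))
                  ; (there v∈e) → x∈p∪q⁺ (inj₁ (covers v∈e)) }
    ; rainbow = rainbow′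
    }
    where
    old-colour : ∀ {v} → v ∈ reps → ¬ c zero ≡ c (suc v)
    old-colour v∈reps same = new (subst (_∈ colours) (sym same) (covers (reps⊆e v∈reps)))
    rainbow′ : ∀ {u v} → u ∈ (inside ∷ reps) → v ∈ (inside ∷ reps) → c u ≡ c v → u ≡ v
    rainbow′ here       here       _    = refl
    rainbow′ here       (there hv) same = contradiction same (old-colour hv)
    rainbow′ (there hu) here       same = contradiction (sym same) (old-colour hu)
    rainbow′ (there hu) (there hv) same = cong suc (rainbow hu hv same)

transversal : {n r : ℕ} (c : Coloring n r) (e : Subset n) → Transversal c e
transversal {r = r} c [] = record
  { reps = [] ; colours = ⊥ ; reps⊆e = λ () ; size = sym (∣⊥∣≡0 r) ; covers = λ () ; rainbow = λ () }
transversal c (outside ∷ e) = skip-vertex c (transversal (c ∘ suc) e) outside λ ()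
transversal c (inside ∷ e) with c zero ∈? Transversal.colours (transversal (c ∘ suc) e)
... | yes old = skip-vertex c (transversal (c ∘ suc) e) inside (λ _ → old)
... | no  new = add-vertex c (transversal (c ∘ suc) e) new

Confined : {n r : ℕ} (q : ℕ) (e : Subset n) (c : Coloring n r) → Set
Confined {r = r} q e c = Σ (Subset r) (λ K → K ∈ₗ subsetsOfSize r q × (∀ {v} → v ∈ e → c v ∈ K))

rainbow-or-confined : {n r : ℕ} (p : ℕ) (c : Coloring n r) (e : Subset n) → p ∸ 1 ≤ r →
  ProperlyColored p c e ⊎ Confined (p ∸ 1) e c
rainbow-or-confined p c e q≤r = by-size (p ≤? ∣ reps ∣)
  where
  open Transversal (transversal c e)
  by-size : Dec (p ≤ ∣ reps ∣) → ProperlyColored p c e ⊎ Confined (p ∸ 1) e c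
  by-size (yes p≤∣reps∣) = inj₁ (reps , reps⊆e , ≤-trans (m⊓n≤m p _) p≤∣reps∣ , λ _ _ → rainbow)
  by-size (no  p≰∣reps∣) =
    let ∣colours∣≤q = subst (_≤ p ∸ 1) size (∸-monoˡ-≤ 1 (≰⇒> p≰∣reps∣))
        (K , K∈ , colours⊆K) = extend-to-size _ (p ∸ 1) colours ∣colours∣≤q q≤r in
    inj₂ (K , K∈ , colours⊆K ∘ covers)

-- Counting the colourings confined on one edge

colourings : (n r : ℕ) → List (Coloring n r)
colourings n r = tuples n (allFin r)

mapsInto : {n r : ℕ} → Subset n → Subset r → Coloring n r → Bool
mapsInto {n} e K c = every n (λ v → not (lookup e v) ∨ lookup K (c v))

mapsInto-intro : {n r : ℕ} (e : Subset n) (K : Subset r) (c : Coloring n r) →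
  (∀ {v} → v ∈ e → c v ∈ K) → T (mapsInto e K c)
mapsInto-intro {n} e K c e↦K = every-intro n _ at
  where
  at : ∀ v → T (not (lookup e v) ∨ lookup K (c v))
  at v with lookup e v in v∈e
  ... | false = tt
  ... | true  = subst T (sym ([]=⇒lookup (e↦K (lookup⇒[]= v e v∈e)))) tt

confined : {n r : ℕ} → ℕ → Subset n → Coloring n r → Bool
confined {r = r} q e c = any (λ K → mapsInto e K c) (subsetsOfSize r q)

Confined⇒confined : {n r : ℕ} (q : ℕ) (e : Subset n) (c : Coloring n r) →
  Confined q e c → T (confined q e c)
Confined⇒confined q e c (K , K∈ , e↦K) =
  any⁺ _ (Any.map (λ { refl → mapsInto-intro e K c e↦K }) K∈)

unconfined⇒proper : {n r : ℕ} (p : ℕ) (c : Coloring n r) (e : Subset n) → p ∸ 1 ≤ r →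
  ¬ T (confined (p ∸ 1) e c) → ProperlyColored p c e
unconfined⇒proper p c e q≤r unconfined with rainbow-or-confined p c e q≤r
... | inj₁ proper     = proper
... | inj₂ isConfined = contradiction (Confined⇒confined (p ∸ 1) e c isConfined) unconfined

∏-on-edge : {n : ℕ} (e : Subset n) (a b : ℕ) →
  ∏ n (λ v → if lookup e v then a else b) * b ^ ∣ e ∣ ≡ a ^ ∣ e ∣ * b ^ n
∏-on-edge []                  a b = refl
∏-on-edge {suc n} (inside ∷ e) a b = begin
  a * W * (b * b ^ ∣ e ∣)          ≡⟨ interchange a W b (b ^ ∣ e ∣) ⟩
  a * b * (W * b ^ ∣ e ∣)          ≡⟨ cong (a * b *_) (∏-on-edge e a b) ⟩
  a * b * (a ^ ∣ e ∣ * b ^ n)      ≡⟨ interchange a b (a ^ ∣ e ∣) (b ^ n) ⟩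
  a * a ^ ∣ e ∣ * (b * b ^ n)      ∎
  where
  open ≡-Reasoning
  W : ℕ
  W = ∏ n (λ v → if lookup e v then a else b)
∏-on-edge {suc n} (outside ∷ e) a b = begin
  b * W * b ^ ∣ e ∣                ≡⟨ *-assoc b W (b ^ ∣ e ∣) ⟩
  b * (W * b ^ ∣ e ∣)              ≡⟨ cong (b *_) (∏-on-edge e a b) ⟩
  b * (a ^ ∣ e ∣ * b ^ n)          ≡⟨ x∙yz≈y∙xz b (a ^ ∣ e ∣) (b ^ n) ⟩
  a ^ ∣ e ∣ * (b * b ^ n)          ∎
  where
  open ≡-Reasoning
  W : ℕ
  W = ∏ n (λ v → if lookup e v then a else b)

count-mapsInto : {n r : ℕ} (e : Subset n) (K : Subset r) →
  count (mapsInto e K) (colourings n r) * r ^ ∣ e ∣ ≡ ∣ K ∣ ^ ∣ e ∣ * r ^ n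
count-mapsInto {n} {r} e K = begin
  count (mapsInto e K) (colourings n r) * r ^ ∣ e ∣
    ≡⟨ cong (_* r ^ ∣ e ∣) (count-tuples n (λ v → allowed (lookup e v)) (allFin r)) ⟩
  ∏ n (λ v → count (allowed (lookup e v)) (allFin r)) * r ^ ∣ e ∣
    ≡⟨ cong (_* r ^ ∣ e ∣) (∏-cong n _ _ (λ v → count-allowed (lookup e v))) ⟩
  ∏ n (λ v → if lookup e v then ∣ K ∣ else r) * r ^ ∣ e ∣
    ≡⟨ ∏-on-edge e ∣ K ∣ r ⟩
  ∣ K ∣ ^ ∣ e ∣ * r ^ n ∎
  where
  open ≡-Reasoning
  allowed : Bool → Fin r → Bool
  allowed b j = not b ∨ lookup K j
  count-allowed : ∀ b → count (allowed b) (allFin r) ≡ (if b then ∣ K ∣ else r)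
  count-allowed true  = count-allFin K
  count-allowed false = trans (count-true (allFin r)) (length-allFin r)

count-confined : {n r : ℕ} (q : ℕ) (e : Subset n) →
  count (confined q e) (colourings n r) * r ^ ∣ e ∣ ≤ (r C q) * (q ^ ∣ e ∣ * r ^ n)
count-confined {n} {r} q e =
  subst (λ N → count (confined q e) (colourings n r) * r ^ ∣ e ∣ ≤ N * (q ^ ∣ e ∣ * r ^ n))
        (length-subsetsOfSize r q)
        (union-bound (mapsInto e) (colourings n r) (r ^ ∣ e ∣) _ (subsetsOfSize r q)
          (All.map (λ {K} ∣K∣≡q → ≤-reflexive (trans (count-mapsInto e K)
                                    (cong (λ s → s ^ ∣ e ∣ * r ^ n) ∣K∣≡q)))
                   (size-subsetsOfSize r q)))

-- Counting the families of colourings that are bad for some edge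

families : (n r x : ℕ) → List (Fin x → Coloring n r)
families n r x = tuples x (colourings n r)

badFamily : {n r : ℕ} (x q : ℕ) → Subset n → (Fin x → Coloring n r) → Bool
badFamily x q e cs = every x (λ i → confined q e (cs i))

badForSome : {n r : ℕ} (x q : ℕ) (G : Hypergraph n) → (Fin x → Coloring n r) → Bool
badForSome x q G cs = any (λ e → badFamily x q e cs) (edges G)

^-distribʳ-* : (a b x : ℕ) → (a * b) ^ x ≡ a ^ x * b ^ x
^-distribʳ-* a b zero    = refl
^-distribʳ-* a b (suc x) =
  trans (cong (a * b *_) (^-distribʳ-* a b x)) (interchange a b (a ^ x) (b ^ x))

count-badFamily : {n r : ℕ} (x q k : ℕ) (e : Subset n) → ∣ e ∣ ≡ k →
  count (badFamily x q e) (families n r x) * (r ^ k) ^ x ≤ (q ^ k * (r C q)) ^ x * (r ^ n) ^ x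
count-badFamily {n} {r} x q k e refl = begin
  count (badFamily x q e) (families n r x) * (r ^ k) ^ x
    ≡⟨ cong (_* (r ^ k) ^ x) (trans (count-tuples x (λ _ → confined q e) (colourings n r))
                                    (∏-const x _)) ⟩
  Bad ^ x * (r ^ k) ^ x
    ≡⟨ sym (^-distribʳ-* Bad (r ^ k) x) ⟩
  (Bad * r ^ k) ^ x
    ≤⟨ ^-monoˡ-≤ x (count-confined q e) ⟩
  ((r C q) * (q ^ k * r ^ n)) ^ x
    ≡⟨ cong (_^ x) (trans (sym (*-assoc (r C q) (q ^ k) (r ^ n)))
                          (cong (_* r ^ n) (*-comm (r C q) (q ^ k)))) ⟩
  (q ^ k * (r C q) * r ^ n) ^ x
    ≡⟨ ^-distribʳ-* (q ^ k * (r C q)) (r ^ n) x ⟩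
  (q ^ k * (r C q)) ^ x * (r ^ n) ^ x ∎
  where
  open ≤-Reasoning
  Bad : ℕ
  Bad = count (confined q e) (colourings n r)

length-families : (n r x : ℕ) → length (families n r x) ≡ (r ^ n) ^ x
length-families n r x = trans (length-tuples x (colourings n r))
  (cong (_^ x) (trans (length-tuples n (allFin r)) (cong (_^ n) (length-allFin r))))

count-bad-families : {n : ℕ} (r x q k : ℕ) (G : Hypergraph n) → Uniform k G →
  count (badForSome x q G) (families n r x) * (r ^ k) ^ x
    ≤ numEdges G * ((q ^ k * (r C q)) ^ x * (r ^ n) ^ x)
count-bad-families {n} r x q k G uniform =
  union-bound (badFamily x q) (families n r x) _ _ (edges G)
    (All.map (λ {e} → count-badFamily x q k e) uniform)

fewer-than-half : (A E H N R : ℕ) .{{_ : NonZero R}} →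
  A * R ≤ E * (H * N) → 2 * E * H ≤ R → 2 * A ≤ N
fewer-than-half A E H N R AR≤EHN 2EH≤R = *-cancelʳ-≤ (2 * A) N R (begin
  2 * A * R         ≡⟨ *-assoc 2 A R ⟩
  2 * (A * R)       ≤⟨ *-monoʳ-≤ 2 AR≤EHN ⟩
  2 * (E * (H * N)) ≡⟨ cong (2 *_) (sym (*-assoc E H N)) ⟩
  2 * (E * H * N)   ≡⟨ sym (*-assoc 2 (E * H) N) ⟩
  2 * (E * H) * N   ≡⟨ cong (_* N) (sym (*-assoc 2 E H)) ⟩
  2 * E * H * N     ≤⟨ *-monoˡ-≤ N 2EH≤R ⟩
  R * N             ≡⟨ *-comm R N ⟩
  N * R             ∎)
  where open ≤-Reasoning

half<whole : (A N : ℕ) → 2 * A ≤ N → 0 < N → A < N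
half<whole zero    N _    0<N = 0<N
half<whole (suc a) N 2A≤N _   = <-≤-trans (m<m+n (suc a) (s≤s z≤n)) 2A≤N

good-family-covers : {n : ℕ} (r p x : ℕ) (G : Hypergraph n) → p ∸ 1 ≤ r →
  (cs : Fin x → Coloring n r) → ¬ T (badForSome x (p ∸ 1) G cs) →
  StrongCover r p G x cs
good-family-covers r p x G q≤r cs good =
  All.map covered (All.¬Any⇒All¬ (edges G) (good ∘ any⁺ _))
  where
  covered : ∀ {e} → ¬ T (badFamily x (p ∸ 1) e cs) → Σ (Fin x) (λ i → ProperlyColored p (cs i) e)
  covered {e} notBad =
    let (i , unconfined) = every-elim x _ notBad in i , unconfined⇒proper p (cs i) e q≤r unconfined

mainTheorem8 : (r p k x : ℕ) → 1 ≤ r → 1 ≤ p → 1 ≤ k → 1 ≤ x →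
    2 ≤ p → p ≤ r → p ≤ k →
    (n : ℕ) (G : Hypergraph n) → Uniform k G →
    2 * numEdges G * ((p ∸ 1) ^ k * (r C (p ∸ 1))) ^ x ≤ r ^ (k * x) →
    χᶜ≤ G r p x
mainTheorem8 r p k x 1≤r _ _ _ _ p≤r _ n G uniform sparse =
  cs , good-family-covers r p x G (≤-trans (m∸n≤m p 1) p≤r) cs good
  where
  instance
    r≢0 : NonZero r
    r≢0 = >-nonZero 1≤r
  q #bad : ℕ
  q = p ∸ 1
  #bad = count (badForSome x q G) (families n r x)
  2·#bad≤all : 2 * #bad ≤ (r ^ n) ^ x
  2·#bad≤all = fewer-than-half #bad (numEdges G) ((q ^ k * (r C q)) ^ x) ((r ^ n) ^ x) ((r ^ k) ^ x)
    {{m^n≢0 (r ^ k) x {{m^n≢0 r k}}}}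
    (count-bad-families r x q k G uniform)
    (subst (2 * numEdges G * (q ^ k * (r C q)) ^ x ≤_) (sym (^-*-assoc r k x)) sparse)
  someGood : #bad < length (families n r x)
  someGood = subst (#bad <_) (sym (length-families n r x))
    (half<whole #bad ((r ^ n) ^ x) 2·#bad≤all (m^n>0 (r ^ n) {{m^n≢0 r n}} x))
  cs : Fin x → Coloring n r
  cs = proj₁ (count-witness (badForSome x q G) (families n r x) someGood)
  good : ¬ T (badForSome x q G cs)
  good = proj₂ (count-witness (badForSome x q G) (families n r x) someGood)
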